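{- Let $T_2$ be the tree with vertices $w,x,y,z,u_1,a_1,b_1$ and edges $wx,xy,yz,zu_1,u_1a_1,u_1b_1$, and let $T_3$ be the tree obtained from $T_2$ by adding vertices $u_2,a_2,b_2$ and edges $zu_2,u_2a_2,u_2b_2$. Let $v$ be a vertex of $T_2$, $S$ a $\Delta_S$-star with $\Delta_S\ge3$, and $G=T_2\rhd_v S$ of order $n$ and maximum degree $\Delta\ge3$, with $G$ not isomorphic to $T_3$. Then $\gamma^{\rm ID}(G)\le\left(\frac{\Delta-1}{\Delta}\right)n$.
   Context: A $\Delta$-star is $K_{1,\Delta}$. $G'\rhd_v S$ denotes the graph obtained from the disjoint union of $G'$ and $S$ by identifying the vertex $v$ of $G'$ with a leaf of $S$. An identifying code of $G$ is a set $C\subseteq V(G)$ such that every vertex $v$ satisfies $N[v]\cap C\neq\emptyset$ and distinct vertices $u,v$ satisfy $N[u]\cap C\neq N[v]\cap C$, where $N[v]$ is the closed neighborhood; $\gamma^{\rm ID}(G)$ is its minimum size. -}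

module Defs where

open import Data.Nat using (ℕ; zero; suc; _+_; _*_; _∸_; _≤_; _⊔_; _≡ᵇ_; _≤ᵇ_)
open import Data.Bool using (Bool; true; false; _∨_; _∧_; T)
open import Data.Bool.Properties using (∨-comm)
open import Data.Fin using (Fin; toℕ)
open import Data.Fin.Subset using (Subset; _∈_; ∣_∣)
open import Data.List using (List; foldr; map; length; filter)
open import Data.List.Base using ()
open import Data.Fin.Base using ()
open import Data.Vec.Functional using ()
open import Data.List using (allFin)
open import Data.Product using (Σ; _×_; _,_)
open import Data.Sum using (_⊎_)
open import Relation.Nullary using (¬_)
open import Relation.Nullary.Decidable using (T?)
open import Relation.Binary.PropositionalEquality using (_≡_; refl)
open import Function.Bundles using (_⇔_; _↔_; Inverse)

record Graph : Set where
  field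
    order  : ℕ
    adj    : Fin order → Fin order → Bool
    sym    : ∀ u v → adj u v ≡ adj v u
    irrefl : ∀ v → adj v v ≡ false

open Graph public

InClosedNbhd : (G : Graph) → Fin (order G) → Fin (order G) → Set
InClosedNbhd G v u = (u ≡ v) ⊎ T (adj G v u)

degree : (G : Graph) → Fin (order G) → ℕ
degree G v = length (filter (λ u → T? (adj G v u)) (allFin (order G)))

maxDegree : (G : Graph) → ℕ
maxDegree G = foldr _⊔_ 0 (map (degree G) (allFin (order G)))

IsIdentifyingCode : (G : Graph) → Subset (order G) → Set
IsIdentifyingCode G C =
  (∀ v → Σ (Fin (order G)) λ w → (w ∈ C) × InClosedNbhd G v w)
  × (∀ u v → ¬ (u ≡ v) →
       ¬ (∀ w → ((w ∈ C) × InClosedNbhd G u w) ⇔ ((w ∈ C) × InClosedNbhd G v w)))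

_≅_ : Graph → Graph → Set
G ≅ H = Σ (Fin (order G) ↔ Fin (order H)) λ f →
          ∀ u v → adj H (Inverse.to f u) (Inverse.to f v) ≡ adj G u v

-- The concrete graphs.
-- T₂ vertices: 0=w 1=x 2=y 3=z 4=u₁ 5=a₁ 6=b₁

t2edge : ℕ → ℕ → Bool
t2edge 0 1 = true
t2edge 1 2 = true
t2edge 2 3 = true
t2edge 3 4 = true
t2edge 4 5 = true
t2edge 4 6 = true
t2edge _ _ = false

-- T₃ : additionally 7=u₂ 8=a₂ 9=b₂, edges z u₂, u₂ a₂, u₂ b₂
t3edge : ℕ → ℕ → Bool
t3edge 3 7 = true
t3edge 7 8 = true
t3edge 7 9 = true
t3edge i j = t2edge i j

t3adj : Fin 10 → Fin 10 → Bool
t3adj i j = t3edge (toℕ i) (toℕ j) ∨ t3edge (toℕ j) (toℕ i)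

t3irr : ∀ k → t3edge k k ≡ false
t3irr 0 = refl
t3irr 1 = refl
t3irr 2 = refl
t3irr 3 = refl
t3irr 4 = refl
t3irr 5 = refl
t3irr 6 = refl
t3irr 7 = refl
t3irr 8 = refl
t3irr 9 = refl
t3irr (suc (suc (suc (suc (suc (suc (suc (suc (suc (suc k)))))))))) = refl

T₃ : Graph
T₃ = record
  { order  = 10
  ; adj    = t3adj
  ; sym    = λ u v → ∨-comm (t3edge (toℕ u) (toℕ v)) (t3edge (toℕ v) (toℕ u))
  ; irrefl = λ v → lemma (toℕ v)
  }
  where
  lemma : ∀ k → t3edge k k ∨ t3edge k k ≡ false
  lemma k rewrite t3irr k = refl

-- T₂ ▷_v S for a d-star S (d = Δ_S).  Vertex set Fin (7 + d):
-- 0..6 are the vertices of T₂, 7 is the centre of S, 8..6+d are the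
-- d - 1 leaves of S other than the one identified with v.
joinEdge : Fin 7 → ℕ → ℕ → Bool
joinEdge v i j = t2edge i j ∨ ((i ≡ᵇ 7) ∧ (8 ≤ᵇ j)) ∨ ((j ≡ᵇ 7) ∧ (i ≡ᵇ toℕ v))

joinAdj : (d : ℕ) → Fin 7 → Fin (7 + d) → Fin (7 + d) → Bool
joinAdj d v i j = joinEdge v (toℕ i) (toℕ j) ∨ joinEdge v (toℕ j) (toℕ i)

joinIrr : ∀ v k → joinEdge v k k ≡ false
joinIrr v 0 = refl
joinIrr v 1 = refl
joinIrr v 2 = refl
joinIrr v 3 = refl
joinIrr v 4 = refl
joinIrr v 5 = refl
joinIrr v 6 = refl
joinIrr Fin.zero 7 = refl
joinIrr (Fin.suc Fin.zero) 7 = refl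
joinIrr (Fin.suc (Fin.suc Fin.zero)) 7 = refl
joinIrr (Fin.suc (Fin.suc (Fin.suc Fin.zero))) 7 = refl
joinIrr (Fin.suc (Fin.suc (Fin.suc (Fin.suc Fin.zero)))) 7 = refl
joinIrr (Fin.suc (Fin.suc (Fin.suc (Fin.suc (Fin.suc Fin.zero))))) 7 = refl
joinIrr (Fin.suc (Fin.suc (Fin.suc (Fin.suc (Fin.suc (Fin.suc Fin.zero)))))) 7 = refl
joinIrr v (suc (suc (suc (suc (suc (suc (suc (suc k)))))))) = refl

T₂▷S : (d : ℕ) → Fin 7 → Graph
T₂▷S d v = record
  { order  = 7 + d
  ; adj    = joinAdj d v
  ; sym    = λ i j → ∨-comm (joinEdge v (toℕ i) (toℕ j)) (joinEdge v (toℕ j) (toℕ i))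
  ; irrefl = λ i → lemma (toℕ i)
  }
  where
  lemma : ∀ k → joinEdge v k k ∨ joinEdge v k k ≡ false
  lemma k rewrite joinIrr v k = refl

{-# OPTIONS --safe #-}
module Submission where

-- Write d = Δ_S, so that n = d + 7 and the centre of S has degree d.  A code missing s
-- vertices meets the bound as soon as n ≤ s Δ.  For d ≥ 4 we drop s = 3 vertices
-- (w, a₁ and one leaf of S): all remaining leaves of S are code vertices and separate
-- themselves, so the code is identifying for every d, and n = d + 7 ≤ 3d ≤ 3Δ.  For d = 3
-- (n = 10) one needs codes missing s = 4 vertices, found by search for each v; the only
-- exception is v = z, where G is T₃, whose identifying codes have at least 7 vertices.

open import Defs hiding (sym)
open import Data.Nat using (ℕ; zero; suc; _+_; _*_; _∸_; _≤_; _≡ᵇ_; s≤s)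
open import Data.Nat.Properties
  using (≤-trans; ≤-reflexive; m≤m+n; n≤1+n; m≤n*m; +-mono-≤; *-monoʳ-≤; +-cancelˡ-≤;
         *-suc; *-comm; *-zeroʳ; *-distribˡ-+; m≤n⇒m≤n⊔o; m≤n⇒m≤o⊔n; module ≤-Reasoning)
  renaming (_≟_ to _≟ℕ_)
open import Data.Bool using (Bool; true; not; T)
open import Data.Bool.ListAction using (any)
open import Data.Bool.Properties using (T-≡) renaming (_≟_ to _≟ᵇ_)
open import Data.Fin using (Fin; zero; suc; toℕ; _↑ˡ_; _↑ʳ_)
open import Data.Fin.Patterns
open import Data.Fin.Properties using (_≟_; all?; any?)
open import Data.Fin.Subset using (Subset; _∈_; ∣_∣; ⊤)
open import Data.Fin.Subset.Properties using (∣⊤∣≡n)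
open import Data.List using (List; []; _∷_; filter; length)
import Data.List as List
open import Data.List.Properties using (filter-all; length-tabulate; foldr-preservesᵒ)
open import Data.List.Relation.Unary.All.Properties using (tabulate⁺)
import Data.List.Relation.Unary.Any as Any
open import Data.List.Membership.Propositional.Properties using (∈-map⁺; ∈-allFin)
open import Data.Vec using (tabulate)
open import Data.Vec.Properties
  using (lookup∘tabulate; []=⇒lookup; lookup⇒[]=; tabulate-∘; map-const)
open import Data.Product using (Σ; ∃; _×_; _,_)
import Data.Product as Product
open import Data.Sum using (_⊎_; inj₁; inj₂; [_,_]; [_,_]′)
open import Data.Unit using (tt)
open import Function using (_∘_; id; const)
open import Function.Bundles using (_⇔_; mk⇔; Equivalence)
open import Function.Construct.Identity using (↔-id)
open import Relation.Nullary using (¬_; Dec; ¬?)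
open import Relation.Nullary.Decidable using (T?; toWitness; _×-dec_; _⊎-dec_; _→-dec_)
import Relation.Nullary.Decidable as Dec
open import Relation.Binary.PropositionalEquality
  using (_≡_; _≢_; refl; sym; trans; cong; subst; subst₂)

-- The code is given by an indicator function rather than a vector, so that membership of
-- a vertex computes even when the vertex, or the order of G, contains a variable.
module IndicatorCode (G : Graph) (f : Fin (order G) → Bool) where

  code : Subset (order G)
  code = tabulate f

  T⇔∈code : ∀ w → T (f w) ⇔ w ∈ code
  T⇔∈code w = mk⇔
    (λ fw → lookup⇒[]= w code (trans (lookup∘tabulate f w) (Equivalence.to T-≡ fw)))
    (λ w∈code → Equivalence.from T-≡ (trans (sym (lookup∘tabulate f w)) ([]=⇒lookup w∈code)))

  Covers : (w u : Fin (order G)) → Set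
  Covers w u = w ∈ code × InClosedNbhd G u w

  Separates : (w u v : Fin (order G)) → Set
  Separates w u v = Covers w u × ¬ Covers w v ⊎ ¬ Covers w u × Covers w v

  covers? : ∀ w u → Dec (Covers w u)
  covers? w u = Dec.map (T⇔∈code w) (T? (f w)) ×-dec (w ≟ u ⊎-dec T? (adj G u w))

  separates? : ∀ w u v → Dec (Separates w u v)
  separates? w u v = covers? w u ×-dec ¬? (covers? w v) ⊎-dec ¬? (covers? w u) ×-dec covers? w v

  separates-sym : ∀ {w u v} → Separates w u v → Separates w v u
  separates-sym (inj₁ (wu , ¬wv)) = inj₂ (¬wv , wu)
  separates-sym (inj₂ (¬wu , wv)) = inj₁ (wv , ¬wu)

  covers-self : ∀ {w} → T (f w) → Covers w w
  covers-self {w} fw = Equivalence.to (T⇔∈code w) fw , inj₁ refl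

  self-separates : ∀ {w v} → T (f w) → w ≢ v → ¬ T (adj G v w) → Separates w w v
  self-separates {w} fw w≢v ¬vw = inj₁ (covers-self fw , ¬covers)
    where
    ¬covers : ¬ Covers w _
    ¬covers (_ , inj₁ w≡v) = w≢v w≡v
    ¬covers (_ , inj₂ vw)  = ¬vw vw

  isIdentifyingCode : (∀ u → ∃ λ w → Covers w u) → (∀ u v → u ≢ v → ∃ λ w → Separates w u v) →
                      IsIdentifyingCode G code
  isIdentifyingCode covered separated = covered , distinct
    where
    distinct : ∀ u v → u ≢ v → ¬ (∀ w → Covers w u ⇔ Covers w v)
    distinct u v u≢v same with separated u v u≢v
    ... | w , inj₁ (wu , ¬wv) = ¬wv (Equivalence.to (same w) wu)
    ... | w , inj₂ (¬wu , wv) = ¬wu (Equivalence.from (same w) wv)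

degree≤maxDegree : ∀ G u → degree G u ≤ maxDegree G
degree≤maxDegree G u =
  foldr-preservesᵒ (λ x y → [ m≤n⇒m≤n⊔o y , m≤n⇒m≤o⊔n x ]) 0 _
    (inj₂ (Any.map ≤-reflexive (∈-map⁺ (degree G) (∈-allFin u))))

c*Δ≤[Δ∸1]*[s+c] : ∀ s c Δ → s + c ≤ s * Δ → c * Δ ≤ (Δ ∸ 1) * (s + c)
c*Δ≤[Δ∸1]*[s+c] s c zero    _       = ≤-reflexive (*-zeroʳ c)
c*Δ≤[Δ∸1]*[s+c] s c (suc D) s+c≤s*Δ = begin
  c * suc D     ≡⟨ *-suc c D ⟩
  c + c * D     ≤⟨ +-mono-≤ c≤s*D (≤-reflexive (*-comm c D)) ⟩
  s * D + D * c ≡⟨ cong (_+ D * c) (*-comm s D) ⟩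
  D * s + D * c ≡⟨ sym (*-distribˡ-+ D s c) ⟩
  D * (s + c)   ∎
  where
  open ≤-Reasoning
  c≤s*D : c ≤ s * D
  c≤s*D = +-cancelˡ-≤ s c (s * D) (subst (s + c ≤_) (*-suc s D) s+c≤s*Δ)

data SplitView (m n : ℕ) : Fin (m + n) → Set where
  inl : (i : Fin m) → SplitView m n (i ↑ˡ n)
  inr : (j : Fin n) → SplitView m n (m ↑ʳ j)

splitView : ∀ m {n} (u : Fin (m + n)) → SplitView m n u
splitView zero    u       = inr u
splitView (suc m) zero    = inl zero
splitView (suc m) (suc u) with splitView m u
... | inl i = inl (suc i)
... | inr j = inr j

indicator : ∀ {n} → List ℕ → Fin n → Bool
indicator xs i = any (toℕ i ≡ᵇ_) xs

smallCodeVertices : Fin 7 → List ℕ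
smallCodeVertices 0F = 0 ∷ 3 ∷ 4 ∷ 5 ∷ 7 ∷ 8 ∷ []
smallCodeVertices 1F = 1 ∷ 2 ∷ 5 ∷ 6 ∷ 7 ∷ 8 ∷ []
smallCodeVertices 2F = 0 ∷ 2 ∷ 5 ∷ 6 ∷ 7 ∷ 8 ∷ []
smallCodeVertices 3F = 0 ∷ 2 ∷ 3 ∷ 4 ∷ 5 ∷ 7 ∷ 8 ∷ []
smallCodeVertices 4F = 0 ∷ 2 ∷ 4 ∷ 5 ∷ 7 ∷ 8 ∷ []
smallCodeVertices 5F = 0 ∷ 2 ∷ 4 ∷ 5 ∷ 7 ∷ 8 ∷ []
smallCodeVertices 6F = 0 ∷ 2 ∷ 4 ∷ 6 ∷ 7 ∷ 8 ∷ []

module Small (v : Fin 7) = IndicatorCode (T₂▷S 3 v) (indicator (smallCodeVertices v))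

small-covered : ∀ v u → ∃ λ w → Small.Covers v w u
small-covered = toWitness {a? = all? λ v → all? λ u → any? λ w → Small.covers? v w u} tt

small-separated : ∀ v u u′ → u ≢ u′ → ∃ λ w → Small.Separates v w u u′
small-separated = toWitness
  {a? = all? λ v → all? λ u → all? λ u′ → ¬? (u ≟ u′) →-dec any? λ w → Small.separates? v w u u′} tt

small-identifying : ∀ v → IsIdentifyingCode (T₂▷S 3 v) (Small.code v)
small-identifying v = Small.isIdentifyingCode v (small-covered v) (small-separated v)

small-size : ∀ v → v ≢ 3F → ∣ Small.code v ∣ ≡ 6
small-size = toWitness {a? = all? λ v → ¬? (v ≟ 3F) →-dec ∣ Small.code v ∣ ≟ℕ 6} tt

T₂▷S₃[z]≅T₃ : T₂▷S 3 3F ≅ T₃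
T₂▷S₃[z]≅T₃ =
  ↔-id (Fin 10) , toWitness {a? = all? λ u → all? λ w → t3adj u w ≟ᵇ joinAdj 3 3F u w} tt

-- For d = 4 + k the vertices of T₂ ▷ᵥ S are the 11 fixed ones i ↑ˡ k (T₂, the centre 7F and
-- the leaves 8, 9, 10) and the k further leaves 11 ↑ʳ j.  Statements about fixed vertices
-- are still decided by evaluation, since their adjacency does not depend on k.
largeIndicator : ∀ {n} → Fin n → Bool
largeIndicator = not ∘ indicator (0 ∷ 5 ∷ 8 ∷ [])

module Large (k : ℕ) (v : Fin 7) = IndicatorCode (T₂▷S (4 + k) v) largeIndicator

fixed-covered : ∀ k v i → ∃ λ w → Large.Covers k v (w ↑ˡ k) (i ↑ˡ k)
fixed-covered k = toWitness
  {a? = all? λ v → all? λ i → any? λ w → Large.covers? k v (w ↑ˡ k) (i ↑ˡ k)} tt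

fixed-separated : ∀ k v i i′ → i ≢ i′ → ∃ λ w → Large.Separates k v (w ↑ˡ k) (i ↑ˡ k) (i′ ↑ˡ k)
fixed-separated k = toWitness
  {a? = all? λ v → all? λ i → all? λ i′ → ¬? (i ≟ i′) →-dec
        any? λ w → Large.separates? k v (w ↑ˡ k) (i ↑ˡ k) (i′ ↑ˡ k)} tt

-- The leaf covers itself, but 11 ↑ʳ j ≟ 11 ↑ʳ j does not evaluate for a variable j.
fixed-leaf-separated : ∀ k v i (j : Fin k) →
  ¬ Large.Covers k v (11 ↑ʳ j) (i ↑ˡ k) ⊎ ∃ λ w → Large.Separates k v (w ↑ˡ k) (i ↑ˡ k) (11 ↑ʳ j)
fixed-leaf-separated k v i j = toWitness
  {a? = all? λ v → all? λ i → ¬? (Large.covers? k v (11 ↑ʳ j) (i ↑ˡ k)) ⊎-dec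
        any? λ w → Large.separates? k v (w ↑ˡ k) (i ↑ˡ k) (11 ↑ʳ j)} tt v i

large-identifying : ∀ k v → IsIdentifyingCode (T₂▷S (4 + k) v) (Large.code k v)
large-identifying k v = isIdentifyingCode covered separated
  where
  open Large k v

  covered : ∀ u → ∃ λ w → Covers w u
  covered u with splitView 11 u
  ... | inl i = Product.map (_↑ˡ k) id (fixed-covered k v i)
  ... | inr j = 11 ↑ʳ j , covers-self tt

  fixed-leaf : ∀ i j → ∃ λ w → Separates w (i ↑ˡ k) (11 ↑ʳ j)
  fixed-leaf i j =
    [ (λ ¬covers → 11 ↑ʳ j , inj₂ (¬covers , covers-self tt)) , Product.map (_↑ˡ k) id ]′
      (fixed-leaf-separated k v i j)

  separated : ∀ u u′ → u ≢ u′ → ∃ λ w → Separates w u u′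
  separated u u′ u≢u′ with splitView 11 u | splitView 11 u′
  ... | inl i | inl i′ = Product.map (_↑ˡ k) id (fixed-separated k v i i′ (u≢u′ ∘ cong (_↑ˡ k)))
  ... | inl i | inr j  = fixed-leaf i j
  ... | inr j | inl i  = Product.map id separates-sym (fixed-leaf i j)
  ... | inr j | inr _  = 11 ↑ʳ j , self-separates tt u≢u′ (λ ())

large-size : ∀ k v → ∣ Large.code k v ∣ ≡ 8 + k
large-size k v = cong (8 +_) (trans (cong ∣_∣ tabulate-true≡⊤) (∣⊤∣≡n k))
  where
  tabulate-true≡⊤ : tabulate {n = k} (const true) ≡ ⊤
  tabulate-true≡⊤ = trans (tabulate-∘ (const true) id) (map-const _ true)

leaves-adjacent : ∀ k v →
  length (filter (T? ∘ adj (T₂▷S (4 + k) v) 7F) (List.tabulate (11 ↑ʳ_))) ≡ k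
leaves-adjacent k v = trans (cong length all-kept) (length-tabulate (11 ↑ʳ_))
  where
  all-kept : filter (T? ∘ adj (T₂▷S (4 + k) v) 7F) (List.tabulate (11 ↑ʳ_)) ≡ List.tabulate (11 ↑ʳ_)
  all-kept = filter-all (T? ∘ adj (T₂▷S (4 + k) v) 7F) (tabulate⁺ (λ _ → tt))

centre-degree : ∀ k v → degree (T₂▷S (4 + k) v) 7F ≡ 4 + k
centre-degree k 0F = cong (4 +_) (leaves-adjacent k 0F)
centre-degree k 1F = cong (4 +_) (leaves-adjacent k 1F)
centre-degree k 2F = cong (4 +_) (leaves-adjacent k 2F)
centre-degree k 3F = cong (4 +_) (leaves-adjacent k 3F)
centre-degree k 4F = cong (4 +_) (leaves-adjacent k 4F)
centre-degree k 5F = cong (4 +_) (leaves-adjacent k 5F)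
centre-degree k 6F = cong (4 +_) (leaves-adjacent k 6F)

lemma4p9 : (d : ℕ) → 3 ≤ d → (v : Fin 7) → (n Δ : ℕ) →
    n ≡ order (T₂▷S d v) → Δ ≡ maxDegree (T₂▷S d v) → 3 ≤ Δ →
    ¬ (T₂▷S d v ≅ T₃) →
    Σ (Subset (order (T₂▷S d v))) λ C →
      IsIdentifyingCode (T₂▷S d v) C × (∣ C ∣ * Δ ≤ (Δ ∸ 1) * n)
lemma4p9 0 () _ _ _ _ _ _ _
lemma4p9 1 (s≤s ()) _ _ _ _ _ _ _
lemma4p9 2 (s≤s (s≤s ())) _ _ _ _ _ _ _
lemma4p9 3 _ v _ Δ refl _ 3≤Δ ≇T₃ =
  Small.code v , small-identifying v ,
  subst (λ c → c * Δ ≤ (Δ ∸ 1) * 10) (sym (small-size v v≢z))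
    (c*Δ≤[Δ∸1]*[s+c] 4 6 Δ (≤-trans (m≤m+n 10 2) (*-monoʳ-≤ 4 3≤Δ)))
  where
  v≢z : v ≢ 3F
  v≢z refl = ≇T₃ T₂▷S₃[z]≅T₃
lemma4p9 (suc (suc (suc (suc k)))) _ v _ Δ refl Δ≡maxDegree _ _ =
  Large.code k v , large-identifying k v ,
  subst (λ c → c * Δ ≤ (Δ ∸ 1) * (11 + k)) (sym (large-size k v))
    (c*Δ≤[Δ∸1]*[s+c] 3 (8 + k) Δ (≤-trans n≤3*d (*-monoʳ-≤ 3 d≤Δ)))
  where
  n≤3*d : 11 + k ≤ 3 * (4 + k)
  n≤3*d = ≤-trans (+-mono-≤ (n≤1+n 11) (m≤n*m k 3)) (≤-reflexive (sym (*-distribˡ-+ 3 4 k)))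
  d≤Δ : 4 + k ≤ Δ
  d≤Δ = subst₂ _≤_ (centre-degree k v) (sym Δ≡maxDegree) (degree≤maxDegree (T₂▷S (4 + k) v) 7F)
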